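{- For any time warp $f$, $n\in\omega\setminus\{0\}$ and $m\in\omega$: $f^{\ell}(n)=m\iff f(m-1)<n\le f(m)$; $f^{\ell}(n)=\omega\iff f(\omega)<n$; $f^{\ell}(\omega)=m\iff f(m)=\omega$ and $f^{\ell}(k)=m$ for some $k\in\omega$; $f^{\ell}(\omega)=\omega\iff f(\omega)<\omega$ or ($f(\omega)=\omega$ and $f(k)<\omega$ for all $k\in\omega$).
   Context: Let $\overline{\omega}=\omega\cup\{\omega\}$ with its natural order. A time warp is a function $f:\overline{\omega}\to\overline{\omega}$ preserving all suprema; equivalently, a monotone function with $f(0)=0$ and $f(\omega)=\bigvee\{f(n)\mid n\in\omega\}$. The set of time warps is ordered pointwise; $\mathrm{id}$ is the identity; the right residual $/$ is characterized by $f\le h/g\iff f\circ g\le h$ for all time warps. Define $f^{\ell}:=\mathrm{id}/f$. -}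

module Defs where

open import Data.Nat using (ℕ; zero; suc; _≤_; _<_; z≤n; s≤s)
import Data.Nat.Properties as ℕP
open import Relation.Binary.PropositionalEquality using (_≡_; refl)
open import Function.Bundles using (_⇔_)

data ℕ∞ : Set where
  fin : ℕ → ℕ∞
  ω   : ℕ∞

data _≤∞_ : ℕ∞ → ℕ∞ → Set where
  fin≤fin : ∀ {m n} → m ≤ n → fin m ≤∞ fin n
  _≤ω     : ∀ x → x ≤∞ ω

data _<∞_ : ℕ∞ → ℕ∞ → Set where
  fin<fin : ∀ {m n} → m < n → fin m <∞ fin n
  fin<ω   : ∀ {m} → fin m <∞ ω

infix 4 _≤∞_ _<∞_

record TimeWarp : Set where
  field
    fun    : ℕ∞ → ℕ∞
    mono   : ∀ {x y} → x ≤∞ y → fun x ≤∞ fun y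
    pres0  : fun (fin 0) ≡ fin 0
    ω-ub   : ∀ n → fun (fin n) ≤∞ fun ω
    ω-least : ∀ u → (∀ n → fun (fin n) ≤∞ u) → fun ω ≤∞ u
open TimeWarp public

_≤ᵗ_ : TimeWarp → TimeWarp → Set
f ≤ᵗ g = ∀ x → fun f x ≤∞ fun g x

infix 4 _≤ᵗ_

idTW : TimeWarp
idTW = record
  { fun = λ x → x
  ; mono = λ p → p
  ; pres0 = refl
  ; ω-ub = λ n → fin n ≤ω
  ; ω-least = least
  }
  where
    least : ∀ u → (∀ n → fin n ≤∞ u) → ω ≤∞ u
    least (fin k) h with h (suc k)
    ... | fin≤fin p = Data.Empty.⊥-elim (ℕP.<-irrefl refl p)
      where import Data.Empty
    least ω h = ω ≤ω

IsResidual : TimeWarp → TimeWarp → TimeWarp → Set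
IsResidual h g r = ∀ (k : TimeWarp) → (k ≤ᵗ r) ⇔ (∀ x → fun k (fun g x) ≤∞ fun h x)

IsLeftWarp : TimeWarp → TimeWarp → Set
IsLeftWarp f r = IsResidual idTW f r

{-# OPTIONS --safe #-}
-- The residual is probed with two-valued time warps: the warp that is 0 up to a and v beyond
-- composes below id with f exactly when v ≤ x whenever f x exceeds a, so it lies below f^ℓ,
-- which yields v ≤ f^ℓ y for y > a. Together with the counit f^ℓ (f x) ≤ x this gives, for
-- every y, that m + 1 ≤ f^ℓ y iff f m < y, and all four clauses are read off from it.
module Submission where

open import Defs
open import Data.Nat using (ℕ; zero; suc; _∸_; _≤_; _≤?_; z≤n; s≤s)
open import Data.Nat.Properties using (≤-refl; ≤-trans; ≤-antisym; ≤-<-trans; <-≤-trans; ≰⇒>; <⇒≱; 1+n≰n)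
open import Data.Product using (_×_; _,_; ∃)
open import Data.Product.Function.NonDependent.Propositional using (_×-⇔_)
open import Data.Sum using (_⊎_; inj₁; inj₂)
open import Relation.Nullary using (¬_; yes; no; contradiction)
open import Relation.Binary.PropositionalEquality using (_≡_; refl; sym; cong; subst)
open import Function.Bundles using (_⇔_; mk⇔; Equivalence)
open import Function.Properties.Equivalence as ⇔ using ()
open import Function.Related.Propositional using (equivalence; module EquationalReasoning)
open import Function.Related.TypeIsomorphisms using (¬-cong-⇔)

≤∞-refl : ∀ {x} → x ≤∞ x
≤∞-refl {fin n} = fin≤fin ≤-refl
≤∞-refl {ω}     = ω ≤ω

≤∞-trans : ∀ {x y z} → x ≤∞ y → y ≤∞ z → x ≤∞ z
≤∞-trans (fin≤fin p) (fin≤fin q) = fin≤fin (≤-trans p q)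
≤∞-trans {x} _       (_ ≤ω)      = x ≤ω

≤∞-antisym : ∀ {x y} → x ≤∞ y → y ≤∞ x → x ≡ y
≤∞-antisym (fin≤fin p) (fin≤fin q) = cong fin (≤-antisym p q)
≤∞-antisym (_ ≤ω)      (_ ≤ω)      = refl

z≤∞ : ∀ x → fin 0 ≤∞ x
z≤∞ (fin n) = fin≤fin z≤n
z≤∞ ω       = fin 0 ≤ω

<∞⇒≱∞ : ∀ {x y} → x <∞ y → ¬ y ≤∞ x
<∞⇒≱∞ (fin<fin p) (fin≤fin q) = <⇒≱ p q

<∞-≤∞-connex : ∀ x y → x <∞ y ⊎ y ≤∞ x
<∞-≤∞-connex (fin m) (fin n) with n ≤? m
... | yes n≤m = inj₂ (fin≤fin n≤m)
... | no  n≰m = inj₁ (fin<fin (≰⇒> n≰m))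
<∞-≤∞-connex (fin m) ω       = inj₁ fin<ω
<∞-≤∞-connex ω       y       = inj₂ (y ≤ω)

≮∞⇔≥∞ : ∀ {x y} → (¬ x <∞ y) ⇔ y ≤∞ x
≮∞⇔≥∞ {x} {y} = mk⇔ ≮⇒≥ (λ y≤x x<y → <∞⇒≱∞ x<y y≤x)
  where
  ≮⇒≥ : ¬ x <∞ y → y ≤∞ x
  ≮⇒≥ x≮y with <∞-≤∞-connex x y
  ... | inj₁ x<y = contradiction x<y x≮y
  ... | inj₂ y≤x = y≤x

<∞⇒fin : ∀ {x y} → x <∞ y → ∃ λ a → x ≡ fin a
<∞⇒fin (fin<fin {a} _) = a , refl
<∞⇒fin (fin<ω {a})     = a , refl

≤∞-<∞-trans : ∀ {x y z} → x ≤∞ y → y <∞ z → x <∞ z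
≤∞-<∞-trans (fin≤fin p) (fin<fin q) = fin<fin (≤-<-trans p q)
≤∞-<∞-trans (fin≤fin p) fin<ω       = fin<ω

<∞-≤∞-trans : ∀ {x y z} → x <∞ y → y ≤∞ z → x <∞ z
<∞-≤∞-trans (fin<fin p) (fin≤fin q) = fin<fin (<-≤-trans p q)
<∞-≤∞-trans (fin<fin p) (_ ≤ω)      = fin<ω
<∞-≤∞-trans fin<ω       (_ ≤ω)      = fin<ω

suc≤∞⇔<∞ : ∀ {m x} → fin (suc m) ≤∞ x ⇔ fin m <∞ x
suc≤∞⇔<∞ = mk⇔ to from
  where
  to : ∀ {m x} → fin (suc m) ≤∞ x → fin m <∞ x
  to (fin≤fin p) = fin<fin p
  to (_ ≤ω)      = fin<ω
  from : ∀ {m x} → fin m <∞ x → fin (suc m) ≤∞ x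
  from (fin<fin p) = fin≤fin p
  from fin<ω       = _ ≤ω

<∞-suc⇔≤∞ : ∀ {x n} → x <∞ fin (suc n) ⇔ x ≤∞ fin n
<∞-suc⇔≤∞ = mk⇔ (λ { (fin<fin (s≤s p)) → fin≤fin p }) (λ { (fin≤fin p) → fin<fin (s≤s p) })

1+n≰∞n : ∀ {n} → ¬ fin (suc n) ≤∞ fin n
1+n≰∞n (fin≤fin p) = 1+n≰n p

≡fin⇔ : ∀ {x m} → x ≡ fin m ⇔ (fin m ≤∞ x × ¬ fin (suc m) ≤∞ x)
≡fin⇔ {x} {m} = mk⇔ to from
  where
  to : x ≡ fin m → fin m ≤∞ x × ¬ fin (suc m) ≤∞ x
  to refl = ≤∞-refl , 1+n≰∞n
  from : fin m ≤∞ x × ¬ fin (suc m) ≤∞ x → x ≡ fin m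
  from (m≤x , 1+m≰x) with <∞-≤∞-connex (fin m) x
  ... | inj₁ m<x = contradiction (Equivalence.from suc≤∞⇔<∞ m<x) 1+m≰x
  ... | inj₂ x≤m = ≤∞-antisym x≤m m≤x

≡ω⇔ω≤∞ : ∀ {x} → x ≡ ω ⇔ ω ≤∞ x
≡ω⇔ω≤∞ = mk⇔ (λ { refl → ω ≤ω }) (λ ω≤x → ≤∞-antisym (_ ≤ω) ω≤x)

ω≤∞⇔ : ∀ {x} → ω ≤∞ x ⇔ (∀ m → fin m <∞ x)
ω≤∞⇔ = mk⇔ (λ ω≤x m → <∞-≤∞-trans fin<ω ω≤x) from
  where
  from : ∀ {x} → (∀ m → fin m <∞ x) → ω ≤∞ x
  from {ω}     _     = ω ≤ω
  from {fin n} below = contradiction (below n) λ { (fin<fin p) → 1+n≰n p }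

∀-cong-⇔ : ∀ {A : Set} {P Q : A → Set} → (∀ a → P a ⇔ Q a) → (∀ a → P a) ⇔ (∀ a → Q a)
∀-cong-⇔ P⇔Q = mk⇔ (λ p a → Equivalence.to (P⇔Q a) (p a)) (λ q a → Equivalence.from (P⇔Q a) (q a))

module _ (f : TimeWarp) where

  fun-≤∞-fun-ω : ∀ x → fun f x ≤∞ fun f ω
  fun-≤∞-fun-ω x = mono f (x ≤ω)

  fun-ω<∞fin⇔ : ∀ {n} → fun f ω <∞ fin n ⇔ (∀ m → fun f (fin m) <∞ fin n)
  fun-ω<∞fin⇔ = mk⇔ (λ fω<n m → ≤∞-<∞-trans (fun-≤∞-fun-ω (fin m)) fω<n) from
    where
    from : ∀ {n} → (∀ m → fun f (fin m) <∞ fin n) → fun f ω <∞ fin n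
    from {zero}  below = contradiction (subst (_<∞ fin 0) (pres0 f) (below 0)) λ { (fin<fin ()) }
    from {suc k} below = Equivalence.from <∞-suc⇔≤∞
                    (ω-least f (fin k) λ m → Equivalence.to <∞-suc⇔≤∞ (below m))

step : ℕ → ℕ∞ → ℕ∞ → ℕ∞
step a v (fin x) with x ≤? a
... | yes _ = fin 0
... | no  _ = v
step a v ω = v

step-≤ : ∀ {a} v {x} → x ≤∞ fin a → step a v x ≡ fin 0
step-≤ {a} _ (fin≤fin {x} x≤a) with x ≤? a
... | yes _    = refl
... | no  x≰a = contradiction x≤a x≰a

step-> : ∀ {a} v {x} → fin a <∞ x → step a v x ≡ v
step-> {a} _ (fin<fin {n = x} a<x) with x ≤? a
... | yes x≤a = contradiction x≤a (<⇒≱ a<x)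
... | no  _   = refl
step-> _ fin<ω = refl

step-≤v : ∀ a v x → step a v x ≤∞ v
step-≤v a v x with <∞-≤∞-connex (fin a) x
... | inj₁ a<x rewrite step-> v a<x = ≤∞-refl
... | inj₂ x≤a rewrite step-≤ v x≤a = z≤∞ v

stepTW : ℕ → ℕ∞ → TimeWarp
stepTW a v = record
  { fun     = step a v
  ; mono    = step-mono
  ; pres0   = step-≤ v (z≤∞ (fin a))
  ; ω-ub    = λ n → step-≤v a v (fin n)
  ; ω-least = λ u below → subst (_≤∞ u) (step-> v (fin<fin ≤-refl)) (below (suc a))
  }
  where
  step-mono : ∀ {x y} → x ≤∞ y → step a v x ≤∞ step a v y
  step-mono {x} {y} x≤y with <∞-≤∞-connex (fin a) y
  ... | inj₁ a<y rewrite step-> v a<y = step-≤v a v x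
  ... | inj₂ y≤a rewrite step-≤ v (≤∞-trans x≤y y≤a) = z≤∞ _

module _ (f fℓ : TimeWarp) (isLeft : IsLeftWarp f fℓ) where

  counit : ∀ x → fun fℓ (fun f x) ≤∞ x
  counit = Equivalence.to (isLeft fℓ) (λ _ → ≤∞-refl)

  step≤fℓ : ∀ {a v y} → (∀ x → v ≤∞ x ⊎ fun f x ≤∞ fin a) → fin a <∞ y → v ≤∞ fun fℓ y
  step≤fℓ {a} {v} {y} split a<y =
    subst (_≤∞ fun fℓ y) (step-> v a<y) (Equivalence.from (isLeft (stepTW a v)) below y)
    where
    below : ∀ x → step a v (fun f x) ≤∞ x
    below x with split x
    ... | inj₁ v≤x  = ≤∞-trans (step-≤v a v (fun f x)) v≤x
    ... | inj₂ fx≤a rewrite step-≤ v fx≤a = z≤∞ x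

  suc≤∞fℓ⇔ : ∀ {m y} → fin (suc m) ≤∞ fun fℓ y ⇔ fun f (fin m) <∞ y
  suc≤∞fℓ⇔ {m} {y} = mk⇔ to from
    where
    to : fin (suc m) ≤∞ fun fℓ y → fun f (fin m) <∞ y
    to 1+m≤fℓy with <∞-≤∞-connex (fun f (fin m)) y
    ... | inj₁ fm<y = fm<y
    ... | inj₂ y≤fm = contradiction (≤∞-trans 1+m≤fℓy (≤∞-trans (mono fℓ y≤fm) (counit (fin m)))) 1+n≰∞n
    from : fun f (fin m) <∞ y → fin (suc m) ≤∞ fun fℓ y
    from fm<y with <∞⇒fin fm<y
    ... | a , fm≡a = step≤fℓ split (subst (_<∞ y) fm≡a fm<y)
      where
      split : ∀ x → fin (suc m) ≤∞ x ⊎ fun f x ≤∞ fin a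
      split x with <∞-≤∞-connex (fin m) x
      ... | inj₁ m<x = inj₁ (Equivalence.from suc≤∞⇔<∞ m<x)
      ... | inj₂ x≤m = inj₂ (subst (fun f x ≤∞_) fm≡a (mono f x≤m))

  ω≤∞fℓ⇔ : ∀ {y} → ω ≤∞ fun fℓ y ⇔ (∀ m → fun f (fin m) <∞ y)
  ω≤∞fℓ⇔ = ⇔.trans ω≤∞⇔ (∀-cong-⇔ λ _ → ⇔.trans (⇔.sym suc≤∞⇔<∞) suc≤∞fℓ⇔)

  fin≤∞fℓ⇔ : ∀ {m y} → fin 0 <∞ y → fin m ≤∞ fun fℓ y ⇔ fun f (fin (m ∸ 1)) <∞ y
  fin≤∞fℓ⇔ {zero}  {y} 0<y = mk⇔ (λ _ → subst (_<∞ y) (sym (pres0 f)) 0<y) (λ _ → z≤∞ _)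
  fin≤∞fℓ⇔ {suc m}     _   = suc≤∞fℓ⇔

  -- For an arbitrary time warp in place of fℓ only ¬ ¬ ∃ k would follow; here k = 1 + f (m - 1).
  fin≤∞fℓω⇒∃ : ∀ {m} → fin m ≤∞ fun fℓ ω → ∃ λ k → fin m ≤∞ fun fℓ (fin k)
  fin≤∞fℓω⇒∃ {zero}  _        = 0 , z≤∞ _
  fin≤∞fℓω⇒∃ {suc m} 1+m≤fℓω with <∞⇒fin (Equivalence.to suc≤∞fℓ⇔ 1+m≤fℓω)
  ... | a , fm≡a = suc a , Equivalence.from suc≤∞fℓ⇔ (subst (_<∞ fin (suc a)) (sym fm≡a) (fin<fin ≤-refl))

  fun-fin≡ω⇔ : ∀ {m} → fun f (fin m) ≡ ω ⇔ (¬ fin (suc m) ≤∞ fun fℓ ω)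
  fun-fin≡ω⇔ = ⇔.trans ≡ω⇔ω≤∞ (⇔.trans (⇔.sym ≮∞⇔≥∞) (¬-cong-⇔ (⇔.sym suc≤∞fℓ⇔)))

  fℓ-fin≡fin⇔ : ∀ {n m} → 1 ≤ n →
    fun fℓ (fin n) ≡ fin m ⇔ (fun f (fin (m ∸ 1)) <∞ fin n × fin n ≤∞ fun f (fin m))
  fℓ-fin≡fin⇔ {n} {m} 1≤n = begin
    (fun fℓ (fin n) ≡ fin m)
      ∼⟨ ≡fin⇔ ⟩
    (fin m ≤∞ fun fℓ (fin n) × ¬ fin (suc m) ≤∞ fun fℓ (fin n))
      ∼⟨ fin≤∞fℓ⇔ (fin<fin 1≤n) ×-⇔ ¬-cong-⇔ suc≤∞fℓ⇔ ⟩
    (fun f (fin (m ∸ 1)) <∞ fin n × ¬ fun f (fin m) <∞ fin n)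
      ∼⟨ ⇔.refl ×-⇔ ≮∞⇔≥∞ ⟩
    (fun f (fin (m ∸ 1)) <∞ fin n × fin n ≤∞ fun f (fin m))
      ∎
    where open EquationalReasoning {k = equivalence}

  fℓ-fin≡ω⇔ : ∀ {n} → fun fℓ (fin n) ≡ ω ⇔ fun f ω <∞ fin n
  fℓ-fin≡ω⇔ = ⇔.trans ≡ω⇔ω≤∞ (⇔.trans ω≤∞fℓ⇔ (⇔.sym (fun-ω<∞fin⇔ f)))

  fℓ-ω≡fin⇔ : ∀ {m} → fun fℓ ω ≡ fin m ⇔ (fun f (fin m) ≡ ω × ∃ λ k → fun fℓ (fin k) ≡ fin m)
  fℓ-ω≡fin⇔ {m} = mk⇔ to from
    where
    to : fun fℓ ω ≡ fin m → fun f (fin m) ≡ ω × ∃ λ k → fun fℓ (fin k) ≡ fin m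
    to fℓω≡m with Equivalence.to ≡fin⇔ fℓω≡m
    ... | m≤fℓω , 1+m≰fℓω with fin≤∞fℓω⇒∃ m≤fℓω
    ... | k , m≤fℓk = Equivalence.from fun-fin≡ω⇔ 1+m≰fℓω
                    , k , ≤∞-antisym (subst (fun fℓ (fin k) ≤∞_) fℓω≡m (fun-≤∞-fun-ω fℓ (fin k))) m≤fℓk
    from : fun f (fin m) ≡ ω × ∃ (λ k → fun fℓ (fin k) ≡ fin m) → fun fℓ ω ≡ fin m
    from (fm≡ω , k , fℓk≡m) = ≤∞-antisym (subst (λ z → fun fℓ z ≤∞ fin m) fm≡ω (counit (fin m)))
                                         (subst (_≤∞ fun fℓ ω) fℓk≡m (fun-≤∞-fun-ω fℓ (fin k)))

  fℓ-ω≡ω⇔ : fun fℓ ω ≡ ω ⇔ (fun f ω <∞ ω ⊎ (fun f ω ≡ ω × ((k : ℕ) → fun f (fin k) <∞ ω)))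
  fℓ-ω≡ω⇔ = ⇔.trans ≡ω⇔ω≤∞ (⇔.trans ω≤∞fℓ⇔ (mk⇔ to from))
    where
    to : (∀ k → fun f (fin k) <∞ ω) → fun f ω <∞ ω ⊎ (fun f ω ≡ ω × (∀ k → fun f (fin k) <∞ ω))
    to finite with <∞-≤∞-connex (fun f ω) ω
    ... | inj₁ fω<ω = inj₁ fω<ω
    ... | inj₂ ω≤fω = inj₂ (Equivalence.from ≡ω⇔ω≤∞ ω≤fω , finite)
    from : fun f ω <∞ ω ⊎ (fun f ω ≡ ω × (∀ k → fun f (fin k) <∞ ω)) → ∀ k → fun f (fin k) <∞ ω
    from (inj₁ fω<ω)      k = ≤∞-<∞-trans (fun-≤∞-fun-ω f (fin k)) fω<ω
    from (inj₂ (_ , finite)) = finite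

lemma2p7 : (f fℓ : TimeWarp) → IsLeftWarp f fℓ →
    ((n m : ℕ) → 1 ≤ n →
      (fun fℓ (fin n) ≡ fin m) ⇔ (fun f (fin (m ∸ 1)) <∞ fin n × fin n ≤∞ fun f (fin m)))
    × ((n : ℕ) → 1 ≤ n → (fun fℓ (fin n) ≡ ω) ⇔ (fun f ω <∞ fin n))
    × ((m : ℕ) → (fun fℓ ω ≡ fin m) ⇔ (fun f (fin m) ≡ ω × ∃ (λ k → fun fℓ (fin k) ≡ fin m)))
    × ((fun fℓ ω ≡ ω) ⇔ (fun f ω <∞ ω ⊎ (fun f ω ≡ ω × ((k : ℕ) → fun f (fin k) <∞ ω))))
lemma2p7 f fℓ isLeft =
    (λ _ _ 1≤n → fℓ-fin≡fin⇔ f fℓ isLeft 1≤n)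
  , (λ _ _ → fℓ-fin≡ω⇔ f fℓ isLeft)
  , (λ _ → fℓ-ω≡fin⇔ f fℓ isLeft)
  , fℓ-ω≡ω⇔ f fℓ isLeft
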